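{- Let $\phi:\mathrm{Bag}(\tau)\to\mathrm{Bag}(\tau)$ be a monoid homomorphism and $\delta:\mathrm{Bag}(\tau)\to\mathrm{Bag}(\tau)$ an aggregation function. The following three properties are equivalent: (1) for all bags $a,b$, $a\equiv_\delta b$ implies $\phi(a)\equiv_\delta\phi(b)$; (2) for all bags $a,b$, $\phi(a\otimes_\delta b)\equiv_\delta \phi(a)\otimes_\delta\phi(b)$; (3) $\delta\circ\phi\circ\delta=\delta\circ\phi$.
   Context: $\mathrm{Bag}(\tau)$ denotes the monoid of finite bags of values of type $\tau$ under bag union $\uplus$ with neutral element the empty bag $\{\!\!\}$; a monoid homomorphism $\phi$ satisfies $\phi(\{\!\!\})=\{\!\!\}$ and $\phi(a\uplus b)=\phi(a)\uplus\phi(b)$. An aggregation function is a function $\delta:\mathrm{Bag}(\tau)\to\mathrm{Bag}(\tau)$ such that $\delta(\{\!\!\})=\{\!\!\}$ and $\delta(a\uplus b)=\delta(\delta(a)\uplus\delta(b))$ for all bags $a,b$. Notation: $a\equiv_\delta b$ iff $\delta(a)=\delta(b)$; $a\otimes_\delta b=\delta(a\uplus b)$. -}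

module Defs where

open import Data.List using (List; []; _++_)
open import Data.List.Relation.Binary.Permutation.Propositional using (_↭_)
open import Function.Base using (_∘_)

-- Finite bags over τ are represented as lists, with bag equality being
-- permutation equivalence _↭_ (Agda has no quotient types).
Bag : Set → Set
Bag τ = List τ

_⊎ᵇ_ : {τ : Set} → Bag τ → Bag τ → Bag τ
a ⊎ᵇ b = a ++ b

∅ᵇ : {τ : Set} → Bag τ
∅ᵇ = []

-- A function on lists is a well-defined function on bags iff it respects ↭.
WellDefined : {τ : Set} → (Bag τ → Bag τ) → Set
WellDefined {τ} f = ∀ {a b : Bag τ} → a ↭ b → f a ↭ f b

record IsBagHom {τ : Set} (φ : Bag τ → Bag τ) : Set where
  field
    wellDefined : WellDefined φ
    preserves-∅ : φ ∅ᵇ ↭ ∅ᵇ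
    preserves-⊎ : ∀ (a b : Bag τ) → φ (a ⊎ᵇ b) ↭ (φ a ⊎ᵇ φ b)

record IsAggregation {τ : Set} (δ : Bag τ → Bag τ) : Set where
  field
    wellDefined : WellDefined δ
    δ-∅ : δ ∅ᵇ ↭ ∅ᵇ
    δ-⊎ : ∀ (a b : Bag τ) → δ (a ⊎ᵇ b) ↭ δ (δ a ⊎ᵇ δ b)

_≡[_]_ : {τ : Set} → Bag τ → (Bag τ → Bag τ) → Bag τ → Set
a ≡[ δ ] b = δ a ↭ δ b

⊗[_] : {τ : Set} → (Bag τ → Bag τ) → Bag τ → Bag τ → Bag τ
⊗[ δ ] a b = δ (a ⊎ᵇ b)

Prop1 : {τ : Set} → (φ δ : Bag τ → Bag τ) → Set
Prop1 {τ} φ δ = ∀ (a b : Bag τ) → a ≡[ δ ] b → φ a ≡[ δ ] φ b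

Prop2 : {τ : Set} → (φ δ : Bag τ → Bag τ) → Set
Prop2 {τ} φ δ = ∀ (a b : Bag τ) → φ (⊗[ δ ] a b) ≡[ δ ] ⊗[ δ ] (φ a) (φ b)

Prop3 : {τ : Set} → (φ δ : Bag τ → Bag τ) → Set
Prop3 {τ} φ δ = ∀ (a : Bag τ) → (δ ∘ φ ∘ δ) a ↭ (δ ∘ φ) a

{-# OPTIONS --safe #-}
module Submission where

-- Taking b = ∅ in the aggregation law shows that δ is idempotent, so a ≡[ δ ] δ a for
-- every bag a. Property (3) is therefore the instance of (1) for the pair (δ a, a), and
-- it implies (1) by rewriting δ (φ a) as δ (φ (δ a)). Since φ preserves ⊎, (3) at a ⊎ b is
-- (2); conversely, (2) at b = ∅ together with φ ∅ ↭ ∅ is (3).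

open import Defs
open import Data.Product using (_×_; _,_)
open import Function.Base using (_∘_)
open import Function.Bundles using (_⇔_; mk⇔)
open import Data.List.Relation.Binary.Permutation.Propositional
  using (_↭_; ↭-trans; module PermutationReasoning)
open import Data.List.Relation.Binary.Permutation.Propositional.Properties
  using (++⁺ˡ; ++-identityʳ)

open PermutationReasoning

⊎ᵇ-∅ʳ : {τ : Set} (a : Bag τ) {b : Bag τ} → b ↭ ∅ᵇ → a ⊎ᵇ b ↭ a
⊎ᵇ-∅ʳ a b↭∅ = ↭-trans (++⁺ˡ a b↭∅) (++-identityʳ a)

module _ {τ : Set} {δ : Bag τ → Bag τ} (A : IsAggregation δ) where
  open IsAggregation A

  aggregation-idempotent : ∀ a → δ (δ a) ↭ δ a
  aggregation-idempotent a = begin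
    δ (δ a)            ↭⟨ wellDefined (⊎ᵇ-∅ʳ (δ a) δ-∅) ⟨
    δ (δ a ⊎ᵇ δ ∅ᵇ)    ↭⟨ δ-⊎ a ∅ᵇ ⟨
    δ (a ⊎ᵇ ∅ᵇ)        ↭⟨ wellDefined (++-identityʳ a) ⟩
    δ a                ∎

module _ {τ : Set} {φ δ : Bag τ → Bag τ} where

  Prop1⇒Prop3 : IsAggregation δ → Prop1 φ δ → Prop3 φ δ
  Prop1⇒Prop3 A p1 a = p1 (δ a) a (aggregation-idempotent A a)

  Prop3⇒Prop1 : WellDefined φ → WellDefined δ → Prop3 φ δ → Prop1 φ δ
  Prop3⇒Prop1 φ-wd δ-wd p3 a b a≡b = begin
    δ (φ a)       ↭⟨ p3 a ⟨
    δ (φ (δ a))   ↭⟨ δ-wd (φ-wd a≡b) ⟩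
    δ (φ (δ b))   ↭⟨ p3 b ⟩
    δ (φ b)       ∎

  module _ (H : IsBagHom φ) (A : IsAggregation δ) where
    open IsBagHom H renaming (wellDefined to φ-wd)
    open IsAggregation A using (wellDefined)

    Prop3⇒Prop2 : Prop3 φ δ → Prop2 φ δ
    Prop3⇒Prop2 p3 a b = begin
      δ (φ (δ (a ⊎ᵇ b)))       ↭⟨ p3 (a ⊎ᵇ b) ⟩
      δ (φ (a ⊎ᵇ b))           ↭⟨ wellDefined (preserves-⊎ a b) ⟩
      δ (φ a ⊎ᵇ φ b)           ↭⟨ aggregation-idempotent A (φ a ⊎ᵇ φ b) ⟨
      δ (δ (φ a ⊎ᵇ φ b))       ∎

    Prop2⇒Prop3 : Prop2 φ δ → Prop3 φ δ
    Prop2⇒Prop3 p2 a = begin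
      δ (φ (δ a))              ↭⟨ wellDefined (φ-wd (wellDefined (++-identityʳ a))) ⟨
      δ (φ (δ (a ⊎ᵇ ∅ᵇ)))      ↭⟨ p2 a ∅ᵇ ⟩
      δ (δ (φ a ⊎ᵇ φ ∅ᵇ))      ↭⟨ aggregation-idempotent A (φ a ⊎ᵇ φ ∅ᵇ) ⟩
      δ (φ a ⊎ᵇ φ ∅ᵇ)          ↭⟨ wellDefined (⊎ᵇ-∅ʳ (φ a) preserves-∅) ⟩
      δ (φ a)                  ∎

mainTheorem3 : {τ : Set} (φ δ : Bag τ → Bag τ) →
    IsBagHom φ → IsAggregation δ →
    (Prop1 φ δ ⇔ Prop2 φ δ) × (Prop2 φ δ ⇔ Prop3 φ δ)
mainTheorem3 φ δ H A =
  mk⇔ (Prop3⇒Prop2 H A ∘ Prop1⇒Prop3 A)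
      (Prop3⇒Prop1 (IsBagHom.wellDefined H) (IsAggregation.wellDefined A) ∘ Prop2⇒Prop3 H A) ,
  mk⇔ (Prop2⇒Prop3 H A) (Prop3⇒Prop2 H A)
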